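{- Let $\mathcal B,\mathcal B^*$ be matroids on a finite set $X$ and $B\mapsto B^*$ a linking $\mathcal B\to\mathcal B^*$. Let $\omega,\pi,a,z,\varepsilon$ be as in the context. Suppose $Q$ is a non-branching almost-basis of $\mathcal B$ and $\varphi(Q)^*=A+a$ or $\varphi(Q)^*=A+z$ for some branching almost-basis $A$ of $\mathcal B^*$. Then $\varepsilon(Q)$ is also a non-branching almost-basis of $\mathcal B$, and both $Q$ and $\varepsilon(Q)$ are balanced.
   Context: A pre-matroid on a finite set $X$ is a non-empty set of subsets of $X$ (bases). For $Y\subseteq X$, $x\notin Y$, $Y+x=Y\cup\{x\}$; for $y\in Y$, $Y-y=Y\setminus\{y\}$. An almost-basis of a pre-matroid $\mathcal C$ is $B-x$ with $B\in\mathcal C$, $x\in B$; $U(D)=\{x\notin D: D+x\in\mathcal C\}$. A matroid is a pre-matroid such that for all bases $B_1,B_2$ and $x\in B_1\setminus B_2$ there is $y\in B_2\setminus B_1$ with $B_1-x+y$ a basis. A transposition of $X$ exchanges two distinct elements and fixes the rest; it acts on subsets elementwise. A bijection $\mathcal B\to\mathcal B^*$, $B\mapsto B^*$, is a linking if for all $B\in\mathcal B$ and transpositions $\tau$: (L1) if $\tau(B)\in\mathcal B$ then $\tau(B^*)\in\mathcal B^*$ and $\tau(B^*)=\tau(B)^*$; (L2) if $\tau(B^*)\in\mathcal B^*$ then $\tau(B)\in\mathcal B$ and $\tau(B^*)=\tau(B)^*$. For a linear order $\rho$ and an almost-basis $D$ of a pre-matroid, $\varphi_\rho(D)=D+\min_\rho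 U(D)$ (computed in that pre-matroid). Let $\omega$ be a linear order on $X$, $a\ne z$ elements consecutive for $\omega$ (nothing strictly between them) with $a<_\omega z$, $\varepsilon$ the transposition of $a,z$, and $\pi$ the linear order agreeing with $\omega$ on all pairs except that $z<_\pi a$. An almost-basis $D$ (of $\mathcal B$ or of $\mathcal B^*$) is branching if $\varphi_\omega(D)\ne\varphi_\pi(D)$ and non-branching otherwise, in which case $\varphi(D)$ denotes the common value. An almost-basis $Q$ of $\mathcal B$ is $\omega$-balanced if $\varepsilon(Q)$ is an almost-basis of $\mathcal B$ and $\varepsilon(\varphi_\omega(Q))=\varphi_\pi(\varepsilon(Q))$; $\pi$-balanced if $\varepsilon(Q)$ is an almost-basis and $\varepsilon(\varphi_\pi(Q))=\varphi_\omega(\varepsilon(Q))$; balanced if both. -}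

module Defs where

open import Data.Nat using (ℕ)
open import Data.Fin using (Fin; _≟_)
open import Data.Fin.Subset using (Subset; _∈_; _∉_; ⁅_⁆; _∪_; outside)
open import Data.Vec using (tabulate; lookup; _[_]≔_)
open import Data.Product using (Σ; ∃; ∃-syntax; _×_; _,_)
open import Data.Sum using (_⊎_)
open import Data.Bool using (if_then_else_)
open import Relation.Nullary using (¬_; does)
open import Relation.Binary.PropositionalEquality using (_≡_; _≢_)
open import Relation.Binary.Structures using (IsStrictTotalOrder)

-- The finite ground set X is Fin n; subsets of X are 'Subset n'.
-- A pre-matroid (set of bases) is a predicate on subsets, plus non-emptiness.
PreMatroid : ℕ → Set₁
PreMatroid n = Subset n → Set

module _ {n : ℕ} where

  _+ₛ_ : Subset n → Fin n → Subset n
  Y +ₛ x = Y ∪ ⁅ x ⁆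

  _-ₛ_ : Subset n → Fin n → Subset n
  Y -ₛ y = Y [ y ]≔ outside

  NonEmpty : PreMatroid n → Set
  NonEmpty 𝒞 = ∃[ B ] 𝒞 B

  IsMatroid : PreMatroid n → Set
  IsMatroid 𝒞 = NonEmpty 𝒞 ×
    (∀ B₁ B₂ x → 𝒞 B₁ → 𝒞 B₂ → x ∈ B₁ → x ∉ B₂ →
       ∃[ y ] (y ∈ B₂ × y ∉ B₁ × 𝒞 ((B₁ -ₛ x) +ₛ y)))

  swap : Fin n → Fin n → Fin n → Fin n
  swap x y i = if does (i ≟ x) then y else (if does (i ≟ y) then x else i)

  act : (Fin n → Fin n) → Subset n → Subset n
  act τ Y = tabulate (λ i → lookup Y (τ i))

  -- a bijection 𝓑 → 𝓑*, represented by a function on subsets whose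
  -- values off 𝓑 are irrelevant
  IsBijection : PreMatroid n → PreMatroid n → (Subset n → Subset n) → Set
  IsBijection 𝓑 𝓑* star =
    (∀ B → 𝓑 B → 𝓑* (star B)) ×
    (∀ B C → 𝓑 B → 𝓑 C → star B ≡ star C → B ≡ C) ×
    (∀ C → 𝓑* C → ∃[ B ] (𝓑 B × star B ≡ C))

  IsLinking : PreMatroid n → PreMatroid n → (Subset n → Subset n) → Set
  IsLinking 𝓑 𝓑* star = IsBijection 𝓑 𝓑* star ×
    (∀ B x y → x ≢ y → 𝓑 B →
       (𝓑 (act (swap x y) B) →
          𝓑* (act (swap x y) (star B)) × act (swap x y) (star B) ≡ star (act (swap x y) B)) ×
       (𝓑* (act (swap x y) (star B)) →
          𝓑 (act (swap x y) B) × act (swap x y) (star B) ≡ star (act (swap x y) B)))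

  IsLinearOrder : (Fin n → Fin n → Set) → Set
  IsLinearOrder ρ = IsStrictTotalOrder _≡_ ρ

  AlmostBasis : PreMatroid n → Subset n → Set
  AlmostBasis 𝒞 D = ∃[ B ] ∃[ x ] (𝒞 B × x ∈ B × D ≡ B -ₛ x)

  U : PreMatroid n → Subset n → Fin n → Set
  U 𝒞 D x = x ∉ D × 𝒞 (D +ₛ x)

  IsPhi : PreMatroid n → (Fin n → Fin n → Set) → Subset n → Subset n → Set
  IsPhi 𝒞 ρ D E = ∃[ u ] (U 𝒞 D u × (∀ v → U 𝒞 D v → v ≢ u → ρ u v) × E ≡ D +ₛ u)

  swapOrder : (Fin n → Fin n → Set) → Fin n → Fin n → Fin n → Fin n → Set
  swapOrder ω a z x y = (ω x y × ¬ (x ≡ a × y ≡ z)) ⊎ (x ≡ z × y ≡ a)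

  Consecutive : (Fin n → Fin n → Set) → Fin n → Fin n → Set
  Consecutive ω a z = ω a z × (∀ x → ¬ (ω a x × ω x z))

  -- branching / non-branching (for almost-bases, where φ always exists)
  Branching : PreMatroid n → (Fin n → Fin n → Set) → (Fin n → Fin n → Set) → Subset n → Set
  Branching 𝒞 ω π D = ∃[ E₁ ] ∃[ E₂ ] (IsPhi 𝒞 ω D E₁ × IsPhi 𝒞 π D E₂ × E₁ ≢ E₂)

  NonBranchingWith : PreMatroid n → (Fin n → Fin n → Set) → (Fin n → Fin n → Set) → Subset n → Subset n → Set
  NonBranchingWith 𝒞 ω π D F = IsPhi 𝒞 ω D F × IsPhi 𝒞 π D F

  NonBranching : PreMatroid n → (Fin n → Fin n → Set) → (Fin n → Fin n → Set) → Subset n → Set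
  NonBranching 𝒞 ω π D = ∃[ F ] NonBranchingWith 𝒞 ω π D F

  BalancedBy : PreMatroid n → (Fin n → Fin n → Set) → (Fin n → Fin n → Set) →
               (Fin n → Fin n) → Subset n → Set
  BalancedBy 𝒞 ρ₁ ρ₂ ε Q = AlmostBasis 𝒞 (act ε Q) ×
    ∃[ E₁ ] ∃[ E₂ ] (IsPhi 𝒞 ρ₁ Q E₁ × IsPhi 𝒞 ρ₂ (act ε Q) E₂ × act ε E₁ ≡ E₂)

  Balanced : PreMatroid n → (Fin n → Fin n → Set) → (Fin n → Fin n → Set) →
             (Fin n → Fin n) → Subset n → Set
  Balanced 𝒞 ω π ε Q = BalancedBy 𝒞 ω π ε Q × BalancedBy 𝒞 π ω ε Q

-- Write φ(Q) = F = Q + u and F* = A + p with {p, q} = {a, z}; that A branches means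
-- φ_ω(A) = A + a and φ_π(A) = A + z.  By (L2), ε(F)* = ε(F*) = A + q, so ε(F) is a basis.
-- A transposition fixes a basis iff it fixes the linked basis, so F separates p and q
-- just as F* does.  If u were a or z, then ε(F) = Q + w for the other element w, and w
-- would be a candidate of Q (an element of U(Q)) lying above u for both ω and π, impossible as ω and π
-- disagree on {a, z}.  Hence ε fixes u and ε(F) = ε(Q) + u, and it remains to see that
-- u is ω-minimal among the candidates of ε(Q) (π-minimality follows since u ≠ a).
-- Candidates p, q of ε(Q) are ε-images of candidates of Q, and u lies below a iff below z
-- because a, z are ω-consecutive.  Any other candidate is handled by basis exchange
-- together with (L1) and the ω-minimality of a among the candidates of A.  Balancedness
-- of Q and ε(Q) is then immediate from φ(ε(Q)) = ε(φ(Q)).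

module Submission where

open import Defs
open import Data.Nat using (ℕ)
open import Data.Bool using (true; false; _∨_)
open import Data.Bool.Properties using (∨-identityʳ; ¬-not)
open import Data.Fin using (Fin; _≟_)
open import Data.Fin.Subset using (Subset; _∈_; _∉_; ⁅_⁆; _∪_; outside)
open import Data.Fin.Subset.Properties using (x∈⁅x⁆; x∈⁅y⁆⇒x≡y; p⊆p∪q; q⊆p∪q; ∪-assoc; ∪-comm)
open import Data.Vec using (lookup)
open import Data.Vec.Properties
  using (lookup∘tabulate; tabulate∘lookup; tabulate-cong; lookup-zipWith;
         lookup∘update; lookup∘update′; []=⇒lookup; lookup⇒[]=)
open import Data.Product using (_×_; _,_; proj₁; proj₂; ∃-syntax)
open import Data.Sum using (_⊎_; inj₁; inj₂; [_,_]′)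
open import Data.Empty using (⊥; ⊥-elim)
open import Function using (id; _∘_)
open import Relation.Nullary using (yes; no)
open import Relation.Binary.PropositionalEquality
open import Relation.Binary.Structures using (IsStrictTotalOrder)
open import Relation.Binary.Definitions using (tri<; tri≈; tri>)

module _ {n : ℕ} where

  ∈⇒lookup≡true : ∀ {Y : Subset n} {i} → i ∈ Y → lookup Y i ≡ true
  ∈⇒lookup≡true = []=⇒lookup

  lookup≡true⇒∈ : ∀ {Y : Subset n} {i} → lookup Y i ≡ true → i ∈ Y
  lookup≡true⇒∈ {Y} {i} = lookup⇒[]= i Y

  ∉⇒lookup≡false : ∀ {Y : Subset n} {i} → i ∉ Y → lookup Y i ≡ false
  ∉⇒lookup≡false i∉Y = ¬-not (i∉Y ∘ lookup≡true⇒∈)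

  lookup≡false⇒∉ : ∀ {Y : Subset n} {i} → lookup Y i ≡ false → i ∉ Y
  lookup≡false⇒∉ e i∈Y with trans (sym (∈⇒lookup≡true i∈Y)) e
  ... | ()

  lookup-≡-∈ : ∀ {Y : Subset n} {x y} → x ∈ Y → y ∈ Y → lookup Y x ≡ lookup Y y
  lookup-≡-∈ x∈Y y∈Y = trans (∈⇒lookup≡true x∈Y) (sym (∈⇒lookup≡true y∈Y))

  lookup-≢-∈-∉ : ∀ {Y : Subset n} {x y} → x ∈ Y → y ∉ Y → lookup Y x ≢ lookup Y y
  lookup-≢-∈-∉ x∈Y y∉Y e with trans (sym (∈⇒lookup≡true x∈Y)) (trans e (∉⇒lookup≡false y∉Y))
  ... | ()

  ∉-of-lookup-≢ : ∀ {Y : Subset n} {x y} → lookup Y x ≢ lookup Y y → x ∈ Y → y ∉ Y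
  ∉-of-lookup-≢ x≁y x∈Y y∈Y = x≁y (lookup-≡-∈ x∈Y y∈Y)

  ∈-of-lookup-≢ : ∀ {Y : Subset n} {x y} → lookup Y x ≢ lookup Y y → x ∉ Y → y ∈ Y
  ∈-of-lookup-≢ x≁y x∉Y =
    lookup≡true⇒∈ (¬-not (λ y∉ → x≁y (trans (∉⇒lookup≡false x∉Y) (sym y∉))))

  subset-ext : ∀ {Y Z : Subset n} → (∀ i → lookup Y i ≡ lookup Z i) → Y ≡ Z
  subset-ext {Y} {Z} h =
    trans (sym (tabulate∘lookup Y)) (trans (tabulate-cong h) (tabulate∘lookup Z))

  lookup-act : ∀ τ (Y : Subset n) i → lookup (act τ Y) i ≡ lookup Y (τ i)
  lookup-act τ Y = lookup∘tabulate _

  ∈-act⁺ : ∀ {τ} {Y : Subset n} {i} → τ i ∈ Y → i ∈ act τ Y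
  ∈-act⁺ {τ} {Y} {i} τi∈Y = lookup≡true⇒∈ (trans (lookup-act τ Y i) (∈⇒lookup≡true τi∈Y))

  ∈-act⁻ : ∀ {τ} {Y : Subset n} {i} → i ∈ act τ Y → τ i ∈ Y
  ∈-act⁻ {τ} {Y} {i} i∈τY = lookup≡true⇒∈ (trans (sym (lookup-act τ Y i)) (∈⇒lookup≡true i∈τY))

  x∈Y+x : ∀ (Y : Subset n) x → x ∈ Y +ₛ x
  x∈Y+x Y x = q⊆p∪q Y ⁅ x ⁆ (x∈⁅x⁆ x)

  ∈-add⁺ : ∀ {Y : Subset n} {x i} → i ∈ Y → i ∈ Y +ₛ x
  ∈-add⁺ {x = x} = p⊆p∪q ⁅ x ⁆

  lookup-add-self : ∀ (Y : Subset n) x → lookup (Y +ₛ x) x ≡ true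
  lookup-add-self Y x = ∈⇒lookup≡true (x∈Y+x Y x)

  lookup-add-other : ∀ (Y : Subset n) {x i} → i ≢ x → lookup (Y +ₛ x) i ≡ lookup Y i
  lookup-add-other Y {x} {i} i≢x = begin
    lookup (Y +ₛ x) i         ≡⟨ lookup-zipWith _∨_ i Y ⁅ x ⁆ ⟩
    lookup Y i ∨ lookup ⁅ x ⁆ i ≡⟨ cong (lookup Y i ∨_) (¬-not (i≢x ∘ x∈⁅y⁆⇒x≡y x ∘ lookup≡true⇒∈)) ⟩
    lookup Y i ∨ false         ≡⟨ ∨-identityʳ _ ⟩
    lookup Y i                 ∎
    where open ≡-Reasoning

  lookup-remove-self : ∀ (Y : Subset n) x → lookup (Y -ₛ x) x ≡ false
  lookup-remove-self Y x = lookup∘update x Y outside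

  lookup-remove-other : ∀ (Y : Subset n) {x i} → i ≢ x → lookup (Y -ₛ x) i ≡ lookup Y i
  lookup-remove-other Y i≢x = lookup∘update′ i≢x Y outside

  ∈-add⁻ : ∀ {Y : Subset n} {x i} → i ∈ Y +ₛ x → i ≢ x → i ∈ Y
  ∈-add⁻ {Y} i∈ i≢x = lookup≡true⇒∈ (trans (sym (lookup-add-other Y i≢x)) (∈⇒lookup≡true i∈))

  ∉-add : ∀ {Y : Subset n} {x i} → i ∉ Y → i ≢ x → i ∉ Y +ₛ x
  ∉-add {Y} i∉Y i≢x = lookup≡false⇒∉ (trans (lookup-add-other Y i≢x) (∉⇒lookup≡false i∉Y))

  x∉Y-x : ∀ (Y : Subset n) x → x ∉ Y -ₛ x
  x∉Y-x Y x = lookup≡false⇒∉ (lookup-remove-self Y x)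

  ∉-remove : ∀ {Y : Subset n} {x i} → i ∉ Y → i ∉ Y -ₛ x
  ∉-remove {Y} {x} {i} i∉Y with i ≟ x
  ... | yes refl = x∉Y-x Y i
  ... | no i≢x = lookup≡false⇒∉ (trans (lookup-remove-other Y i≢x) (∉⇒lookup≡false i∉Y))

  add-comm : ∀ (Y : Subset n) x y → (Y +ₛ x) +ₛ y ≡ (Y +ₛ y) +ₛ x
  add-comm Y x y = begin
    (Y ∪ ⁅ x ⁆) ∪ ⁅ y ⁆  ≡⟨ ∪-assoc Y ⁅ x ⁆ ⁅ y ⁆ ⟩
    Y ∪ (⁅ x ⁆ ∪ ⁅ y ⁆)  ≡⟨ cong (Y ∪_) (∪-comm ⁅ x ⁆ ⁅ y ⁆) ⟩
    Y ∪ (⁅ y ⁆ ∪ ⁅ x ⁆)  ≡⟨ sym (∪-assoc Y ⁅ y ⁆ ⁅ x ⁆) ⟩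
    (Y ∪ ⁅ y ⁆) ∪ ⁅ x ⁆  ∎
    where open ≡-Reasoning

  add-remove-cancel : ∀ {Y : Subset n} {x} → x ∉ Y → (Y +ₛ x) -ₛ x ≡ Y
  add-remove-cancel {Y} {x} x∉Y = subset-ext pointwise
    where
    pointwise : ∀ i → lookup ((Y +ₛ x) -ₛ x) i ≡ lookup Y i
    pointwise i with i ≟ x
    ... | yes refl = trans (lookup-remove-self (Y +ₛ i) i) (sym (∉⇒lookup≡false x∉Y))
    ... | no i≢x = trans (lookup-remove-other (Y +ₛ x) i≢x) (lookup-add-other Y i≢x)

  remove-add-cancel : ∀ {Y : Subset n} {x} → x ∈ Y → (Y -ₛ x) +ₛ x ≡ Y
  remove-add-cancel {Y} {x} x∈Y = subset-ext pointwise
    where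
    pointwise : ∀ i → lookup ((Y -ₛ x) +ₛ x) i ≡ lookup Y i
    pointwise i with i ≟ x
    ... | yes refl = trans (lookup-add-self (Y -ₛ i) i) (sym (∈⇒lookup≡true x∈Y))
    ... | no i≢x = trans (lookup-add-other (Y -ₛ x) i≢x) (lookup-remove-other Y i≢x)

  add-injective : ∀ {Y : Subset n} {x y} → x ∉ Y → Y +ₛ x ≡ Y +ₛ y → x ≡ y
  add-injective {Y} {x} {y} x∉Y eq with x ≟ y
  ... | yes x≡y = x≡y
  ... | no x≢y with trans (sym (lookup-add-self Y x))
                          (trans (cong (λ S → lookup S x) eq)
                                 (trans (lookup-add-other Y x≢y) (∉⇒lookup≡false x∉Y)))
  ...   | ()

  SamePair : Fin n → Fin n → Fin n → Fin n → Set
  SamePair a z p q = (p ≡ a × q ≡ z) ⊎ (p ≡ z × q ≡ a)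

  SamePair-sym : ∀ {a z p q} → SamePair a z p q → SamePair a z q p
  SamePair-sym (inj₁ (p≡a , q≡z)) = inj₂ (q≡z , p≡a)
  SamePair-sym (inj₂ (p≡z , q≡a)) = inj₁ (q≡a , p≡z)

  SamePair-member : ∀ {a z p q} → SamePair a z p q → p ≡ a ⊎ p ≡ z
  SamePair-member (inj₁ (p≡a , _)) = inj₁ p≡a
  SamePair-member (inj₂ (p≡z , _)) = inj₂ p≡z

  SamePair-outside : ∀ {a z p q i} → SamePair a z p q → i ≢ p → i ≢ q → i ≢ a × i ≢ z
  SamePair-outside (inj₁ (refl , refl)) i≢p i≢q = i≢p , i≢q
  SamePair-outside (inj₂ (refl , refl)) i≢p i≢q = i≢q , i≢p

  SamePair-distinct : ∀ {a z p q} → a ≢ z → SamePair a z p q → p ≢ q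
  SamePair-distinct a≢z (inj₁ (refl , refl)) = a≢z
  SamePair-distinct a≢z (inj₂ (refl , refl)) = a≢z ∘ sym

  record Transposes (τ : Fin n → Fin n) (x y : Fin n) : Set where
    field
      image-x : τ x ≡ y
      image-y : τ y ≡ x
      fixes : ∀ {i} → i ≢ x → i ≢ y → τ i ≡ i

  swap-transposes : ∀ x y → Transposes (swap x y) x y
  swap-transposes x y = record { image-x = image-x ; image-y = image-y ; fixes = fixes }
    where
    image-x : swap x y x ≡ y
    image-x with x ≟ x
    ... | yes _ = refl
    ... | no x≢x = ⊥-elim (x≢x refl)
    image-y : swap x y y ≡ x
    image-y with y ≟ x
    ... | yes y≡x = y≡x
    ... | no _ with y ≟ y
    ...   | yes _ = refl
    ...   | no y≢y = ⊥-elim (y≢y refl)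
    fixes : ∀ {i} → i ≢ x → i ≢ y → swap x y i ≡ i
    fixes {i} i≢x i≢y with i ≟ x
    ... | yes i≡x = ⊥-elim (i≢x i≡x)
    ... | no _ with i ≟ y
    ...   | yes i≡y = ⊥-elim (i≢y i≡y)
    ...   | no _ = refl

  transposes-sym : ∀ {τ x y} → Transposes τ x y → Transposes τ y x
  transposes-sym T = record { image-x = image-y ; image-y = image-x ; fixes = λ i≢y i≢x → fixes i≢x i≢y }
    where open Transposes T

  SamePair-transposes : ∀ {a z p q} → SamePair a z p q → Transposes (swap a z) p q
  SamePair-transposes (inj₁ (refl , refl)) = swap-transposes _ _
  SamePair-transposes (inj₂ (refl , refl)) = transposes-sym (swap-transposes _ _)

  module _ {τ x y} (T : Transposes τ x y) where
    open Transposes T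

    involutive : ∀ i → τ (τ i) ≡ i
    involutive i with i ≟ x
    ... | yes refl = trans (cong τ image-x) image-y
    ... | no i≢x with i ≟ y
    ...   | yes refl = trans (cong τ image-y) image-x
    ...   | no i≢y = trans (cong τ (fixes i≢x i≢y)) (fixes i≢x i≢y)

    act-involutive : ∀ Y → act τ (act τ Y) ≡ Y
    act-involutive Y = subset-ext λ i → begin
      lookup (act τ (act τ Y)) i ≡⟨ lookup-act τ (act τ Y) i ⟩
      lookup (act τ Y) (τ i)     ≡⟨ lookup-act τ Y (τ i) ⟩
      lookup Y (τ (τ i))         ≡⟨ cong (lookup Y) (involutive i) ⟩
      lookup Y i                 ∎
      where open ≡-Reasoning

    act-fix : ∀ {Y} → lookup Y x ≡ lookup Y y → act τ Y ≡ Y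
    act-fix {Y} Yx≡Yy = subset-ext λ i → trans (lookup-act τ Y i) (pointwise i)
      where
      pointwise : ∀ i → lookup Y (τ i) ≡ lookup Y i
      pointwise i with i ≟ x
      ... | yes refl = trans (cong (lookup Y) image-x) (sym Yx≡Yy)
      ... | no i≢x with i ≟ y
      ...   | yes refl = trans (cong (lookup Y) image-y) Yx≡Yy
      ...   | no i≢y = cong (lookup Y) (fixes i≢x i≢y)

    act-fix⁻¹ : ∀ {Y} → act τ Y ≡ Y → lookup Y x ≡ lookup Y y
    act-fix⁻¹ {Y} τY≡Y = begin
      lookup Y x          ≡⟨ cong (λ S → lookup S x) (sym τY≡Y) ⟩
      lookup (act τ Y) x  ≡⟨ lookup-act τ Y x ⟩
      lookup Y (τ x)      ≡⟨ cong (lookup Y) image-x ⟩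
      lookup Y y          ∎
      where open ≡-Reasoning

    act-add : ∀ Y i → act τ (Y +ₛ i) ≡ act τ Y +ₛ τ i
    act-add Y i = subset-ext pointwise
      where
      pointwise : ∀ j → lookup (act τ (Y +ₛ i)) j ≡ lookup (act τ Y +ₛ τ i) j
      pointwise j with j ≟ τ i
      ... | yes refl = begin
        lookup (act τ (Y +ₛ i)) (τ i) ≡⟨ lookup-act τ (Y +ₛ i) (τ i) ⟩
        lookup (Y +ₛ i) (τ (τ i))     ≡⟨ cong (lookup (Y +ₛ i)) (involutive i) ⟩
        lookup (Y +ₛ i) i             ≡⟨ lookup-add-self Y i ⟩
        true                          ≡⟨ sym (lookup-add-self (act τ Y) (τ i)) ⟩
        lookup (act τ Y +ₛ τ i) (τ i) ∎
        where open ≡-Reasoning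
      ... | no j≢τi = begin
        lookup (act τ (Y +ₛ i)) j ≡⟨ lookup-act τ (Y +ₛ i) j ⟩
        lookup (Y +ₛ i) (τ j)     ≡⟨ lookup-add-other Y τj≢i ⟩
        lookup Y (τ j)            ≡⟨ sym (lookup-act τ Y j) ⟩
        lookup (act τ Y) j        ≡⟨ sym (lookup-add-other (act τ Y) j≢τi) ⟩
        lookup (act τ Y +ₛ τ i) j ∎
        where
        open ≡-Reasoning
        τj≢i : τ j ≢ i
        τj≢i τj≡i = j≢τi (trans (sym (involutive j)) (cong τ τj≡i))

    act-add-fresh : ∀ {Y} → x ∉ Y → y ∉ Y → act τ (Y +ₛ x) ≡ Y +ₛ y
    act-add-fresh {Y} x∉Y y∉Y = begin
      act τ (Y +ₛ x)    ≡⟨ act-add Y x ⟩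
      act τ Y +ₛ τ x    ≡⟨ cong₂ _+ₛ_ (act-fix (trans (∉⇒lookup≡false x∉Y) (sym (∉⇒lookup≡false y∉Y)))) image-x ⟩
      Y +ₛ y            ∎
      where open ≡-Reasoning

module LinkingProperties {n} {𝓑 𝓑* : PreMatroid n} {star : Subset n → Subset n}
                         (link : IsLinking 𝓑 𝓑* star) where

  star-basis : ∀ {B} → 𝓑 B → 𝓑* (star B)
  star-basis = proj₁ (proj₁ link) _

  star-injective : ∀ {B C} → 𝓑 B → 𝓑 C → star B ≡ star C → B ≡ C
  star-injective = proj₁ (proj₂ (proj₁ link)) _ _

  L1 : ∀ {B x y} → 𝓑 B → x ≢ y → 𝓑 (act (swap x y) B) →
       𝓑* (act (swap x y) (star B)) × act (swap x y) (star B) ≡ star (act (swap x y) B)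
  L1 {B} {x} {y} 𝓑B x≢y = proj₁ (proj₂ link B x y x≢y 𝓑B)

  L2 : ∀ {B x y} → 𝓑 B → x ≢ y → 𝓑* (act (swap x y) (star B)) →
       𝓑 (act (swap x y) B) × act (swap x y) (star B) ≡ star (act (swap x y) B)
  L2 {B} {x} {y} 𝓑B x≢y = proj₂ (proj₂ link B x y x≢y 𝓑B)

  agree⇒agree* : ∀ {B x y} → 𝓑 B → x ≢ y →
                 lookup B x ≡ lookup B y → lookup (star B) x ≡ lookup (star B) y
  agree⇒agree* {B} {x} {y} 𝓑B x≢y Bx≡By = act-fix⁻¹ (swap-transposes x y) (begin
    act (swap x y) (star B) ≡⟨ proj₂ (L1 𝓑B x≢y (subst 𝓑 (sym τB≡B) 𝓑B)) ⟩
    star (act (swap x y) B) ≡⟨ cong star τB≡B ⟩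
    star B                  ∎)
    where
    open ≡-Reasoning
    τB≡B = act-fix (swap-transposes x y) Bx≡By

  agree*⇒agree : ∀ {B x y} → 𝓑 B → x ≢ y →
                 lookup (star B) x ≡ lookup (star B) y → lookup B x ≡ lookup B y
  agree*⇒agree {B} {x} {y} 𝓑B x≢y B*x≡B*y = act-fix⁻¹ (swap-transposes x y) (sym B≡τB)
    where
    τB*≡B* = act-fix (swap-transposes x y) B*x≡B*y
    swapped = L2 𝓑B x≢y (subst 𝓑* (sym τB*≡B*) (star-basis 𝓑B))
    B≡τB = star-injective 𝓑B (proj₁ swapped) (trans (sym τB*≡B*) (proj₂ swapped))

module ConsecutivePair {n} {ω : Fin n → Fin n → Set} (lo : IsLinearOrder ω)
                       {a z : Fin n} (a≢z : a ≢ z) (cons : Consecutive ω a z) where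
  open IsStrictTotalOrder lo using (compare; irrefl) renaming (trans to ω-trans)

  π : Fin n → Fin n → Set
  π = swapOrder ω a z

  ω-asym : ∀ {x y} → ω x y → ω y x → ⊥
  ω-asym ωxy ωyx = irrefl refl (ω-trans ωxy ωyx)

  below-a⇒below-z : ∀ {u} → ω u a → ω u z
  below-a⇒below-z ωua = ω-trans ωua (proj₁ cons)

  below-z⇒below-a : ∀ {u} → u ≢ a → ω u z → ω u a
  below-z⇒below-a {u} u≢a ωuz with compare u a
  ... | tri< ωua _ _ = ωua
  ... | tri≈ _ u≡a _ = ⊥-elim (u≢a u≡a)
  ... | tri> _ _ ωau = ⊥-elim (proj₂ cons u (ωau , ωuz))

  below-pair : ∀ {u x y} → u ≢ a → u ≢ z → x ≡ a ⊎ x ≡ z → y ≡ a ⊎ y ≡ z → ω u x → ω u y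
  below-pair _   _   (inj₁ refl) (inj₁ refl) = id
  below-pair _   _   (inj₁ refl) (inj₂ refl) = below-a⇒below-z
  below-pair u≢a _   (inj₂ refl) (inj₁ refl) = below-z⇒below-a u≢a
  below-pair _   _   (inj₂ refl) (inj₂ refl) = id

  ω⇒π : ∀ {u v} → u ≢ a → ω u v → π u v
  ω⇒π u≢a ωuv = inj₁ (ωuv , λ { (u≡a , _) → u≢a u≡a })

  ω-π-reversal : ∀ {x y} → ω x y → π y x → x ≡ a × y ≡ z
  ω-π-reversal ωxy (inj₁ (ωyx , _)) = ⊥-elim (ω-asym ωxy ωyx)
  ω-π-reversal ωxy (inj₂ (y≡z , x≡a)) = x≡a , y≡z

  ω-π-disagree : ∀ {x y} → SamePair a z x y → ω x y → π x y → ⊥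
  ω-π-disagree (inj₁ (refl , refl)) _ (inj₁ (_ , not-az)) = not-az (refl , refl)
  ω-π-disagree (inj₁ (refl , refl)) _ (inj₂ (a≡z , _)) = a≢z a≡z
  ω-π-disagree (inj₂ (refl , refl)) ωza _ = ω-asym ωza (proj₁ cons)

  branching-candidates : ∀ {𝒞 : PreMatroid n} {D} → Branching 𝒞 ω π D →
    (U 𝒞 D a × (∀ v → U 𝒞 D v → v ≢ a → ω a v)) × U 𝒞 D z
  branching-candidates {𝒞} {D} (E₁ , E₂ , (x , Ux , x-min , E₁≡) , (y , Uy , y-min , E₂≡) , E₁≢E₂) =
    reversed (ω-π-reversal (x-min y Uy (x≢y ∘ sym)) (y-min x Ux x≢y))
    where
    x≢y : x ≢ y
    x≢y x≡y = E₁≢E₂ (trans E₁≡ (trans (cong (D +ₛ_) x≡y) (sym E₂≡)))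
    reversed : x ≡ a × y ≡ z → (U 𝒞 D a × (∀ v → U 𝒞 D v → v ≢ a → ω a v)) × U 𝒞 D z
    reversed (refl , refl) = (Ux , x-min) , Uy

IsCommonMinimum : ∀ {n} → PreMatroid n → (ω π : Fin n → Fin n → Set) → Subset n → Fin n → Set
IsCommonMinimum 𝒞 ω π D u = U 𝒞 D u × (∀ v → U 𝒞 D v → v ≢ u → ω u v × π u v)

module _ {n} {𝒞 : PreMatroid n} where

  candidate⇒almost-basis : ∀ {D x} → U 𝒞 D x → AlmostBasis 𝒞 D
  candidate⇒almost-basis {D} {x} (x∉D , 𝒞D+x) =
    D +ₛ x , x , 𝒞D+x , x∈Y+x D x , sym (add-remove-cancel x∉D)

  phi⇒almost-basis : ∀ {ρ D E} → IsPhi 𝒞 ρ D E → AlmostBasis 𝒞 D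
  phi⇒almost-basis (_ , Ux , _) = candidate⇒almost-basis Ux

  nonbranching⇒common-minimum : ∀ {ω π D F} → NonBranchingWith 𝒞 ω π D F →
                                ∃[ u ] (IsCommonMinimum 𝒞 ω π D u × F ≡ D +ₛ u)
  nonbranching⇒common-minimum {π = π} {D} ((u , Uu , ω-min , F≡) , (u′ , (u′∉D , _) , π-min , F≡′)) =
    u , (Uu , λ v Uv v≢u → ω-min v Uv v≢u , π-min′ v Uv v≢u) , F≡
    where
    u′≡u : u′ ≡ u
    u′≡u = add-injective u′∉D (trans (sym F≡′) F≡)
    π-min′ : ∀ v → U 𝒞 D v → v ≢ u → π u v
    π-min′ v Uv v≢u = subst (λ w → π w v) u′≡u (π-min v Uv (λ v≡u′ → v≢u (trans v≡u′ u′≡u)))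

  common-minimum⇒nonbranching : ∀ {ω π D u} → IsCommonMinimum 𝒞 ω π D u →
                                NonBranchingWith 𝒞 ω π D (D +ₛ u)
  common-minimum⇒nonbranching {u = u} (Uu , u-min) =
    (u , Uu , (λ v Uv v≢u → proj₁ (u-min v Uv v≢u)) , refl) ,
    (u , Uu , (λ v Uv v≢u → proj₂ (u-min v Uv v≢u)) , refl)

  nonbranching-pair⇒balanced : ∀ {ω π ε x y Q F} → Transposes ε x y →
    NonBranchingWith 𝒞 ω π Q F → NonBranchingWith 𝒞 ω π (act ε Q) (act ε F) →
    Balanced 𝒞 ω π ε Q × Balanced 𝒞 ω π ε (act ε Q)
  nonbranching-pair⇒balanced {ε = ε} {Q = Q} {F} T (φωQ , φπQ) (φωεQ , φπεQ) =
    ((εQ-almost , F , act ε F , φωQ , φπεQ , refl) , (εQ-almost , F , act ε F , φπQ , φωεQ , refl)) ,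
    ((εεQ-almost , act ε F , F , φωεQ , back φπQ , εεF≡F) , (εεQ-almost , act ε F , F , φπεQ , back φωQ , εεF≡F))
    where
    εQ-almost = phi⇒almost-basis φωεQ
    εεQ-almost = subst (AlmostBasis 𝒞) (sym (act-involutive T Q)) (phi⇒almost-basis φωQ)
    εεF≡F = act-involutive T F
    back : ∀ {ρ} → IsPhi 𝒞 ρ Q F → IsPhi 𝒞 ρ (act ε (act ε Q)) F
    back {ρ} = subst (λ D → IsPhi 𝒞 ρ D F) (sym (act-involutive T Q))

module SwapStep {n} {𝓑 𝓑* : PreMatroid n} (𝓑-matroid : IsMatroid 𝓑)
  {star : Subset n → Subset n} (link : IsLinking 𝓑 𝓑* star)
  {ω : Fin n → Fin n → Set} (lo : IsLinearOrder ω)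
  {a z : Fin n} (a≢z : a ≢ z) (cons : Consecutive ω a z)
  {Q : Subset n} {u : Fin n} (u-min : IsCommonMinimum 𝓑 ω (swapOrder ω a z) Q u)
  {A : Subset n} {p q : Fin n} (pq : SamePair a z p q) (Ap : U 𝓑* A p) (Aq : U 𝓑* A q)
  (a-min : ∀ v → U 𝓑* A v → v ≢ a → ω a v)
  (F*≡A+p : star (Q +ₛ u) ≡ A +ₛ p) where

  open ConsecutivePair lo a≢z cons
  open LinkingProperties link
  open IsStrictTotalOrder lo using () renaming (trans to ω-trans)
  open Transposes using (image-y; fixes)

  F : Subset n
  F = Q +ₛ u

  ε : Fin n → Fin n
  ε = swap a z

  εQ : Subset n
  εQ = act ε Q

  ε-pq : Transposes ε p q
  ε-pq = SamePair-transposes pq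

  u∉Q : u ∉ Q
  u∉Q = proj₁ (proj₁ u-min)

  𝓑F : 𝓑 F
  𝓑F = proj₂ (proj₁ u-min)

  ω-min : ∀ v → U 𝓑 Q v → v ≢ u → ω u v
  ω-min v Uv v≢u = proj₁ (proj₂ u-min v Uv v≢u)

  u∈F : u ∈ F
  u∈F = x∈Y+x Q u

  p≢q : p ≢ q
  p≢q = SamePair-distinct a≢z pq

  p∈F* : p ∈ star F
  p∈F* = subst (p ∈_) (sym F*≡A+p) (x∈Y+x A p)

  q∉F* : q ∉ star F
  q∉F* = subst (q ∉_) (sym F*≡A+p) (∉-add (proj₁ Aq) (p≢q ∘ sym))

  F-separates-pq : lookup F p ≢ lookup F q
  F-separates-pq = lookup-≢-∈-∉ p∈F* q∉F* ∘ agree⇒agree* 𝓑F p≢q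

  εF-basis : 𝓑 (act ε F)
  εF-basis = proj₁ (L2 𝓑F a≢z (subst 𝓑* (sym εF*≡A+q) (proj₂ Aq)))
    where
    εF*≡A+q : act ε (star F) ≡ A +ₛ q
    εF*≡A+q = trans (cong (act ε) F*≡A+p) (act-add-fresh ε-pq (proj₁ Ap) (proj₁ Aq))

  -- (L1) makes (x p)F* = A + x a basis of 𝓑*, i.e. x a candidate of A.
  a-below : ∀ {x} → x ≢ p → x ≢ a → lookup F x ≢ lookup F p → 𝓑 (act (swap x p) F) → ω a x
  a-below {x} x≢p x≢a Fx≁Fp 𝓑τF = a-min x (x∉A , subst 𝓑* τF*≡A+x (proj₁ (L1 𝓑F x≢p 𝓑τF))) x≢a
    where
    x∉F* : x ∉ star F
    x∉F* x∈F* = Fx≁Fp (agree*⇒agree 𝓑F x≢p (lookup-≡-∈ x∈F* p∈F*))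
    x∉A : x ∉ A
    x∉A = x∉F* ∘ subst (x ∈_) (sym F*≡A+p) ∘ ∈-add⁺
    τF*≡A+x : act (swap x p) (star F) ≡ A +ₛ x
    τF*≡A+x = trans (cong (act (swap x p)) F*≡A+p)
                    (act-add-fresh (transposes-sym (swap-transposes x p)) (proj₁ Ap) x∉A)

  transposed-candidate-excluded : ∀ {τ w} → Transposes τ u w → SamePair a z u w →
                                  w ∉ F → 𝓑 (act τ F) → ⊥
  transposed-candidate-excluded {τ} {w} T uw w∉F 𝓑τF = ω-π-disagree uw ωuw πuw
    where
    w≢u : w ≢ u
    w≢u refl = w∉F u∈F
    Uw : U 𝓑 Q w
    Uw = w∉F ∘ ∈-add⁺ , subst 𝓑 (act-add-fresh T u∉Q (w∉F ∘ ∈-add⁺)) 𝓑τF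
    ωuw = proj₁ (proj₂ u-min w Uw w≢u)
    πuw = proj₂ (proj₂ u-min w Uw w≢u)

  u≢p : u ≢ p
  u≢p refl = transposed-candidate-excluded ε-pq pq (∉-of-lookup-≢ F-separates-pq u∈F) εF-basis

  u≢q : u ≢ q
  u≢q refl = transposed-candidate-excluded (transposes-sym ε-pq) (SamePair-sym pq)
               (∉-of-lookup-≢ (F-separates-pq ∘ sym) u∈F) εF-basis

  εu≡u : ε u ≡ u
  εu≡u = fixes ε-pq u≢p u≢q

  u≢a : u ≢ a
  u≢a = proj₁ (SamePair-outside pq u≢p u≢q)

  below-pq : ∀ {x y} → x ≡ a ⊎ x ≡ z → y ≡ a ⊎ y ≡ z → ω u x → ω u y
  below-pq = below-pair u≢a (proj₂ (SamePair-outside pq u≢p u≢q))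

  Q-separates-pq : lookup Q p ≢ lookup Q q
  Q-separates-pq Qp≡Qq =
    F-separates-pq (trans (lookup-add-other Q (u≢p ∘ sym)) (trans Qp≡Qq (sym (lookup-add-other Q (u≢q ∘ sym)))))

  pair-candidate : ∀ {x y} → Transposes ε x y → lookup Q x ≢ lookup Q y → U 𝓑 εQ x → U 𝓑 Q y
  pair-candidate {x} {y} T Qx≁Qy (x∉εQ , 𝓑εQ+x) = y∉Q , subst 𝓑 εQ+x≡Q+y 𝓑εQ+x
    where
    open Transposes T using (image-x)
    y∉Q : y ∉ Q
    y∉Q = x∉εQ ∘ ∈-act⁺ ∘ subst (_∈ Q) (sym image-x)
    x∈Q : x ∈ Q
    x∈Q = ∈-of-lookup-≢ (Qx≁Qy ∘ sym) y∉Q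
    εQ+x≡Q+y : εQ +ₛ x ≡ Q +ₛ y
    εQ+x≡Q+y = begin
      εQ +ₛ x         ≡⟨ cong (εQ +ₛ_) (sym (image-y T)) ⟩
      εQ +ₛ ε y       ≡⟨ sym (act-add T Q y) ⟩
      act ε (Q +ₛ y)  ≡⟨ act-fix T (lookup-≡-∈ (∈-add⁺ x∈Q) (x∈Y+x Q y)) ⟩
      Q +ₛ y          ∎
      where open ≡-Reasoning

  p-candidate : U 𝓑 Q p → ω u a × p ∈ F
  p-candidate Up = below-pq (SamePair-member pq) (inj₁ refl) ωup , p∈F
    where
    ωup = ω-min p Up (u≢p ∘ sym)
    𝓑τF : 𝓑 (act (swap u p) F)
    𝓑τF = subst 𝓑 (sym (act-add-fresh (swap-transposes u p) u∉Q (proj₁ Up))) (proj₂ Up)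
    p∈F : p ∈ F
    p∈F = lookup≡true⇒∈ (¬-not λ Fp≡false →
      ω-asym (below-pq (SamePair-member pq) (inj₁ refl) ωup)
             (a-below u≢p u≢a (lookup-≢-∈-∉ u∈F (lookup≡false⇒∉ Fp≡false)) 𝓑τF))

  q-candidate : U 𝓑 Q q → ω u a × p ∈ F
  q-candidate Uq = below-pq (SamePair-member (SamePair-sym pq)) (inj₁ refl) (ω-min q Uq (u≢q ∘ sym)) ,
                   ∈-of-lookup-≢ (F-separates-pq ∘ sym) (∉-add (proj₁ Uq) (u≢q ∘ sym))

  -- Exchanging F → ε(Q) + v at u yields v or a candidate of Q in {p, q}; the latter forces
  -- u <ω a and p ∈ F, and then exchanging ε(Q) + v → F at q yields Q + v or (v p)F.
  module OutsidePair {v} (v≢p : v ≢ p) (v≢q : v ≢ q) (v≢u : v ≢ u) (Uv : U 𝓑 εQ v) where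

    G : Subset n
    G = εQ +ₛ v

    G≐Q : ∀ {i} → i ≢ v → i ≢ p → i ≢ q → lookup G i ≡ lookup Q i
    G≐Q {i} i≢v i≢p i≢q =
      trans (lookup-add-other εQ i≢v) (trans (lookup-act ε Q i) (cong (lookup Q) (fixes ε-pq i≢p i≢q)))

    v∉Q : v ∉ Q
    v∉Q = proj₁ Uv ∘ ∈-act⁺ ∘ subst (_∈ Q) (sym (fixes ε-pq v≢p v≢q))

    v∉F : v ∉ F
    v∉F = ∉-add v∉Q v≢u

    exchange-at-u : ω u v ⊎ (ω u a × p ∈ F)
    exchange-at-u = classify (proj₂ 𝓑-matroid F G u 𝓑F (proj₂ Uv) u∈F u∉G)
      where
      u∉G : u ∉ G
      u∉G = lookup≡false⇒∉ (trans (G≐Q (v≢u ∘ sym) u≢p u≢q) (∉⇒lookup≡false u∉Q))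
      candidate-in-G : ∀ {y} → y ∈ G → U 𝓑 Q y → y ≢ u → ω u v ⊎ (ω u a × p ∈ F)
      candidate-in-G {y} y∈G Uy y≢u with y ≟ v | y ≟ p | y ≟ q
      ... | yes refl | _ | _ = inj₁ (ω-min y Uy y≢u)
      ... | no _ | yes refl | _ = inj₂ (p-candidate Uy)
      ... | no _ | no _ | yes refl = inj₂ (q-candidate Uy)
      ... | no y≢v | no y≢p | no y≢q =
        ⊥-elim (proj₁ Uy (lookup≡true⇒∈ (trans (sym (G≐Q y≢v y≢p y≢q)) (∈⇒lookup≡true y∈G))))
      classify : ∃[ y ] (y ∈ G × y ∉ F × 𝓑 ((F -ₛ u) +ₛ y)) → ω u v ⊎ (ω u a × p ∈ F)
      classify (y , y∈G , y∉F , 𝓑F-u+y) = candidate-in-G y∈G Uy (λ { refl → y∉F u∈F })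
        where
        Uy : U 𝓑 Q y
        Uy = y∉F ∘ ∈-add⁺ , subst (λ S → 𝓑 (S +ₛ y)) (add-remove-cancel u∉Q) 𝓑F-u+y

    module _ (p∈Q : p ∈ Q) where

      private
        Q₀ : Subset n
        Q₀ = Q -ₛ p

        q∉Q₀ : q ∉ Q₀
        q∉Q₀ = ∉-remove (∉-of-lookup-≢ Q-separates-pq p∈Q)

        G-q≡Q₀+v : G -ₛ q ≡ Q₀ +ₛ v
        G-q≡Q₀+v = begin
          (act ε Q +ₛ v) -ₛ q          ≡⟨ cong (λ S → (act ε S +ₛ v) -ₛ q) (sym (remove-add-cancel p∈Q)) ⟩
          (act ε (Q₀ +ₛ p) +ₛ v) -ₛ q  ≡⟨ cong (λ S → (S +ₛ v) -ₛ q) (act-add-fresh ε-pq (x∉Y-x Q p) q∉Q₀) ⟩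
          ((Q₀ +ₛ q) +ₛ v) -ₛ q        ≡⟨ cong (_-ₛ q) (add-comm Q₀ q v) ⟩
          ((Q₀ +ₛ v) +ₛ q) -ₛ q        ≡⟨ add-remove-cancel (∉-add q∉Q₀ (v≢q ∘ sym)) ⟩
          Q₀ +ₛ v                      ∎
          where open ≡-Reasoning

      G-q+p≡Q+v : (G -ₛ q) +ₛ p ≡ Q +ₛ v
      G-q+p≡Q+v = begin
        (G -ₛ q) +ₛ p   ≡⟨ cong (_+ₛ p) G-q≡Q₀+v ⟩
        (Q₀ +ₛ v) +ₛ p  ≡⟨ add-comm Q₀ v p ⟩
        (Q₀ +ₛ p) +ₛ v  ≡⟨ cong (_+ₛ v) (remove-add-cancel p∈Q) ⟩
        Q +ₛ v          ∎
        where open ≡-Reasoning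

      G-q+u≡τF : (G -ₛ q) +ₛ u ≡ act (swap v p) F
      G-q+u≡τF = begin
        (G -ₛ q) +ₛ u                          ≡⟨ cong (_+ₛ u) G-q≡Q₀+v ⟩
        (Q₀ +ₛ v) +ₛ u                         ≡⟨ sym (cong₂ _+ₛ_ (act-add-fresh (transposes-sym τ) (x∉Y-x Q p) (∉-remove v∉Q))
                                                                  (fixes τ (v≢u ∘ sym) u≢p)) ⟩
        act (swap v p) (Q₀ +ₛ p) +ₛ swap v p u ≡⟨ sym (act-add τ (Q₀ +ₛ p) u) ⟩
        act (swap v p) ((Q₀ +ₛ p) +ₛ u)        ≡⟨ cong (λ S → act (swap v p) (S +ₛ u)) (remove-add-cancel p∈Q) ⟩
        act (swap v p) F                       ∎
        where
        open ≡-Reasoning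
        τ = swap-transposes v p

    exchange-at-q : p ∈ F → ω u a → ω u v
    exchange-at-q p∈F ωua = classify (proj₂ 𝓑-matroid G F q (proj₂ Uv) 𝓑F q∈G q∉F)
      where
      p∈Q : p ∈ Q
      p∈Q = ∈-add⁻ p∈F (u≢p ∘ sym)
      q∉F : q ∉ F
      q∉F = ∉-of-lookup-≢ F-separates-pq p∈F
      q∈G : q ∈ G
      q∈G = ∈-add⁺ (∈-act⁺ (subst (_∈ Q) (sym (image-y ε-pq)) p∈Q))
      classify : ∃[ y ] (y ∈ F × y ∉ G × 𝓑 ((G -ₛ q) +ₛ y)) → ω u v
      classify (y , y∈F , y∉G , 𝓑G-q+y) with y ≟ u | y ≟ p | y ≟ q
      ... | yes refl | _ | _ =
        ω-trans ωua (a-below v≢p (proj₁ (SamePair-outside pq v≢p v≢q)) (lookup-≢-∈-∉ p∈F v∉F ∘ sym)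
                             (subst 𝓑 (G-q+u≡τF p∈Q) 𝓑G-q+y))
      ... | no _ | yes refl | _ = ω-min v (v∉Q , subst 𝓑 (G-q+p≡Q+v p∈Q) 𝓑G-q+y) v≢u
      ... | no _ | no _ | yes refl = ⊥-elim (q∉F y∈F)
      ... | no y≢u | no y≢p | no y≢q =
        ⊥-elim (y∉G (lookup≡true⇒∈ (trans (G≐Q y≢v y≢p y≢q) (∈⇒lookup≡true (∈-add⁻ y∈F y≢u)))))
        where
        y≢v : y ≢ v
        y≢v refl = v∉F y∈F

    minimal : ω u v
    minimal = [ id , (λ { (ωua , p∈F) → exchange-at-q p∈F ωua }) ]′ exchange-at-u

  εQ-minimal : ∀ v → U 𝓑 εQ v → v ≢ u → ω u v
  εQ-minimal v Uv v≢u with v ≟ p | v ≟ q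
  ... | yes refl | _ =
    below-pq (SamePair-member (SamePair-sym pq)) (SamePair-member pq)
             (ω-min q (pair-candidate ε-pq Q-separates-pq Uv) (u≢q ∘ sym))
  ... | no _ | yes refl =
    below-pq (SamePair-member pq) (SamePair-member (SamePair-sym pq))
             (ω-min p (pair-candidate (transposes-sym ε-pq) (Q-separates-pq ∘ sym) Uv) (u≢p ∘ sym))
  ... | no v≢p | no v≢q = OutsidePair.minimal v≢p v≢q v≢u Uv

  εF≡εQ+u : act ε F ≡ εQ +ₛ u
  εF≡εQ+u = trans (act-add ε-pq Q u) (cong (εQ +ₛ_) εu≡u)

  εQ-nonbranching : NonBranchingWith 𝓑 ω π εQ (act ε F)
  εQ-nonbranching = subst (NonBranchingWith 𝓑 ω π εQ) (sym εF≡εQ+u)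
    (common-minimum⇒nonbranching {𝒞 = 𝓑}
      ((u∉εQ , subst 𝓑 εF≡εQ+u εF-basis) ,
       λ v Uv v≢u → εQ-minimal v Uv v≢u , ω⇒π u≢a (εQ-minimal v Uv v≢u)))
    where
    u∉εQ : u ∉ εQ
    u∉εQ = u∉Q ∘ subst (_∈ Q) εu≡u ∘ ∈-act⁻

theorem9p1 : {n : ℕ} (𝓑 𝓑* : PreMatroid n) → IsMatroid 𝓑 → IsMatroid 𝓑* →
    (star : Subset n → Subset n) → IsLinking 𝓑 𝓑* star →
    (ω : Fin n → Fin n → Set) → IsLinearOrder ω →
    (a z : Fin n) → a ≢ z → Consecutive ω a z →
    (Q : Subset n) → AlmostBasis 𝓑 Q →
    (F : Subset n) → NonBranchingWith 𝓑 ω (swapOrder ω a z) Q F →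
    (∃[ A ] (AlmostBasis 𝓑* A × Branching 𝓑* ω (swapOrder ω a z) A ×
              (star F ≡ A +ₛ a ⊎ star F ≡ A +ₛ z))) →
    AlmostBasis 𝓑 (act (swap a z) Q) ×
    NonBranching 𝓑 ω (swapOrder ω a z) (act (swap a z) Q) ×
    Balanced 𝓑 ω (swapOrder ω a z) (swap a z) Q ×
    Balanced 𝓑 ω (swapOrder ω a z) (swap a z) (act (swap a z) Q)
theorem9p1 𝓑 𝓑* 𝓑-matroid _ star link ω lo a z a≢z cons Q _ F φQ (A , _ , A-branching , F*≡)
  with nonbranching⇒common-minimum {𝒞 = 𝓑} φQ
     | ConsecutivePair.branching-candidates lo a≢z cons {𝒞 = 𝓑*} A-branching
... | u , u-min , refl | (Aa , a-min) , Az =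
  phi⇒almost-basis (proj₁ φεQ) , (act (swap a z) F , φεQ) ,
  nonbranching-pair⇒balanced (swap-transposes a z) φQ φεQ
  where
  step = SwapStep.εQ-nonbranching 𝓑-matroid link lo a≢z cons u-min
  φεQ : NonBranchingWith 𝓑 ω (swapOrder ω a z) (act (swap a z) Q) (act (swap a z) F)
  φεQ = [ step (inj₁ (refl , refl)) Aa Az a-min , step (inj₂ (refl , refl)) Az Aa a-min ]′ F*≡
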